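{- Let $G$ be a graph or digraph and let $A=(A,\alpha)$ and $B=(B,\beta)$ be dacards of $G$ obtained by deleting distinct vertices of $G$. Let $P_1,P_2$ be two dapastings of $A$ and $B$ as members of $\mathrm{Dadeck}(G)$, and let $CP_1$, $CP_2$ be completions of $P_1$, $P_2$ obtained by adding arcs between the respective external vertices. There is an isomorphism from $CP_1$ to $CP_2$ mapping the set of external vertices of $P_1$ onto the set of external vertices of $P_2$ if and only if $P_1$ and $P_2$ are isomorphic as dapastings.
   Context: Digraphs are finite, without loops or multiple arcs; a graph is regarded as a digraph in which every edge is a pair of opposite arcs. For a vertex $x$ of a digraph $D$, $\mathrm{dt}_D(x)=(a,b,c)$ where $a,b,c$ count vertices $w$ such that respectively only $xw$, only $wx$, both $xw,wx$ are arcs. A dacard of $D$ is a pair $(D-x,\mathrm{dt}_D(x))$, with $D-x$ up to isomorphism; $\mathrm{Dadeck}(D)$ is the multiset of dacards; digraphs with the same dadeck are da-hypomorphs. Dapasting: a dapasting of dacards $(A,\alpha),(B,\beta)$ of $G$ (from distinct vertices) as members of $\mathrm{Dadeck}(G)$ is a digraph $P$ with two distinct non-adjacent vertices $u,v$ (external vertices), $u$ labeled $(e,\alpha)$, $v$ labeled $(e,\beta)$, other vertices unlabeled, such that $P-u\cong A$, $P-v\cong B$ and there is $Y\in\{P,P+uv,P+vu,P+uv+vu\}$ ($P+xy$ = $P$ with arc $xy$ added) with $\mathrm{dt}_Y(u)=\alpha$, $\mathrm{dt}_Y(v)=\beta$ and $Y$ da-hypomorphic to $G$; such $Y$ (and any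 digraph isomorphic to it) is a completion of $P$. Two dapastings are isomorphic if there is a digraph isomorphism between them mapping each vertex to a vertex with the same label (unlabeled to unlabeled). -}

module Defs where

open import Data.Nat using (ℕ; zero; suc; _+_)
open import Data.Bool using (Bool; true; false; _∧_; _∨_; not; if_then_else_)
open import Data.Fin using (Fin; zero; suc; punchIn; _≟_)
open import Data.Product using (Σ; _×_; _,_; ∃-syntax)
open import Data.Sum using (_⊎_)
open import Data.Maybe using (Maybe; just; nothing)
open import Relation.Nullary using (¬_; does)
open import Relation.Binary.PropositionalEquality using (_≡_)
open import Function.Bundles using (_↔_; Inverse)

-- A digraph on vertex set Fin n, given by its arc relation (i j ↦ "ij is an arc").
-- A graph is the special case of a symmetric relation.
Digraph : ℕ → Set
Digraph n = Fin n → Fin n → Bool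

Loopless : ∀ {n} → Digraph n → Set
Loopless {n} D = ∀ (i : Fin n) → D i i ≡ false

record _≅_ {n m : ℕ} (D : Digraph n) (E : Digraph m) : Set where
  field
    bij  : Fin n ↔ Fin m
    pres : ∀ i j → E (Inverse.to bij i) (Inverse.to bij j) ≡ D i j

_─_ : ∀ {n} → Digraph (suc n) → Fin (suc n) → Digraph n
(D ─ x) i j = D (punchIn x i) (punchIn x j)

countB : ∀ {n} → (Fin n → Bool) → ℕ
countB {zero}  f = 0
countB {suc n} f = (if f zero then 1 else 0) + countB (λ i → f (suc i))

Triple : Set
Triple = ℕ × ℕ × ℕ

dt : ∀ {n} → Digraph n → Fin n → Triple
dt D x = countB (λ w → D x w ∧ not (D w x))
       , countB (λ w → not (D x w) ∧ D w x)
       , countB (λ w → D x w ∧ D w x)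

-- da-hypomorphism: equality of dadecks as multisets of dacards
-- (each dacard taken up to isomorphism of the card)
DaHypo : ∀ {n} → Digraph (suc n) → Digraph (suc n) → Set
DaHypo {n} G H = Σ (Fin (suc n) ↔ Fin (suc n)) λ σ →
  ∀ x → ((G ─ x) ≅ (H ─ Inverse.to σ x)) × (dt G x ≡ dt H (Inverse.to σ x))

eqB : ∀ {n} → Fin n → Fin n → Bool
eqB i j = does (i ≟ j)

addArcs : ∀ {n} → Digraph n → Fin n → Fin n → Bool → Bool → Digraph n
addArcs P u v b c i j =
  P i j ∨ (b ∧ eqB i u ∧ eqB j v) ∨ (c ∧ eqB i v ∧ eqB j u)

CompletionCond : ∀ {n} (G : Digraph (suc n)) (x y : Fin (suc n))
  (P : Digraph (suc n)) (u v : Fin (suc n)) → Bool → Bool → Set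
CompletionCond G x y P u v b c =
  (dt (addArcs P u v b c) u ≡ dt G x) ×
  (dt (addArcs P u v b c) v ≡ dt G y) ×
  DaHypo (addArcs P u v b c) G

record Dapasting {n} (G : Digraph (suc n)) (x y : Fin (suc n)) : Set where
  field
    P        : Digraph (suc n)
    loopless : Loopless P
    u v      : Fin (suc n)
    u≢v      : ¬ (u ≡ v)
    nonadjUV : P u v ≡ false
    nonadjVU : P v u ≡ false
    delU     : (P ─ u) ≅ (G ─ x)
    delV     : (P ─ v) ≅ (G ─ y)
    complete : ∃[ b ] ∃[ c ] CompletionCond G x y P u v b c

label : ∀ {n} {G : Digraph (suc n)} {x y : Fin (suc n)} →
        Dapasting G x y → Fin (suc n) → Maybe Triple
label {G = G} {x} {y} Q w =
  if eqB w (Dapasting.u Q) then just (dt G x)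
  else if eqB w (Dapasting.v Q) then just (dt G y)
  else nothing

DapIso : ∀ {n} {G : Digraph (suc n)} {x y : Fin (suc n)} →
         Dapasting G x y → Dapasting G x y → Set
DapIso Q R = Σ (Dapasting.P Q ≅ Dapasting.P R) λ f →
  ∀ w → label R (Inverse.to (_≅_.bij f) w) ≡ label Q w

ExtIso : ∀ {n} (Y1 Y2 : Digraph n) (u1 v1 u2 v2 : Fin n) → Set
ExtIso Y1 Y2 u1 v1 u2 v2 = Σ (Y1 ≅ Y2) λ f →
  let g = Inverse.to (_≅_.bij f) in
  ((g u1 ≡ u2) × (g v1 ≡ v2)) ⊎ ((g u1 ≡ v2) × (g v1 ≡ u2))

{-# OPTIONS --safe #-}
-- A pasting P is recovered from any of its completions by deleting the arcs between its
-- external vertices u, v, which P lacks. Hence an isomorphism of completions sending {u₁,v₁}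
-- onto {u₂,v₂} restricts to an isomorphism of pastings; if it swaps the external vertices it
-- carries the degree triple of u₁ to that of v₂, so the two labels agree and are preserved anyway.
-- Conversely a label-preserving isomorphism g of pastings sends the external pair onto the
-- external pair. Transported along g, the completion of P₂ becomes a completion of P₁ that
-- differs from the given one at most in the arcs u₁v₁ and v₁u₁; as both have the prescribed
-- degree triple at u₁ and only these arcs distinguish them there, the added arcs coincide and
-- g extends to the completions.
module Submission where

open import Defs
open import Data.Nat using (ℕ; zero; suc; _+_)
open import Data.Nat.Properties using (+-0-commutativeMonoid; +-cancelˡ-≡; +-cancelʳ-≡)
open import Data.Bool using (Bool; true; false; _∧_; _∨_; not; if_then_else_)
open import Data.Bool.Properties using (∨-comm; ∨-identityʳ; ∧-zeroʳ; ∧-identityʳ)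
open import Data.Fin using (Fin; zero; suc; _≟_)
open import Data.Fin.Properties using (suc-injective)
open import Data.Maybe using (Maybe; just; nothing)
open import Data.Maybe.Properties using (just-injective)
open import Data.Product using (Σ; _×_; _,_; proj₁; proj₂)
open import Data.Sum using (_⊎_; inj₁; inj₂)
open import Function using (_∘_)
open import Function.Bundles using (_⇔_; mk⇔; _↔_; Inverse; Injection)
open import Function.Construct.Identity using (↔-id)
open import Function.Properties.Inverse using (↔⇒↣)
open import Relation.Nullary using (¬_; yes; no; contradiction)
open import Relation.Nullary.Decidable using (dec-true; dec-false; _×-dec_)
open import Relation.Binary.PropositionalEquality
  using (_≡_; _≢_; refl; sym; trans; cong; cong₂; module ≡-Reasoning)
import Algebra.Properties.CommutativeMonoid.Sum as MonoidSum

open MonoidSum +-0-commutativeMonoid using (sum; sum-permute)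
open Inverse using (to)
open _≅_
open ≡-Reasoning

bit : Bool → ℕ
bit b = if b then 1 else 0

bit-injective : ∀ {a b} → bit a ≡ bit b → a ≡ b
bit-injective {false} {false} _ = refl
bit-injective {true}  {true}  _ = refl

countB≡sum : ∀ {n} (f : Fin n → Bool) → countB f ≡ sum (bit ∘ f)
countB≡sum {zero}  f = refl
countB≡sum {suc n} f = cong (bit (f zero) +_) (countB≡sum (f ∘ suc))

countB-cong : ∀ {n} {f g : Fin n → Bool} → (∀ i → f i ≡ g i) → countB f ≡ countB g
countB-cong {zero}  f≗g = refl
countB-cong {suc n} f≗g = cong₂ _+_ (cong bit (f≗g zero)) (countB-cong (f≗g ∘ suc))

countB-permute : ∀ {n} (f : Fin n → Bool) (σ : Fin n ↔ Fin n) → countB (f ∘ to σ) ≡ countB f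
countB-permute f σ = begin
  countB (f ∘ to σ)     ≡⟨ countB≡sum (f ∘ to σ) ⟩
  sum (bit ∘ f ∘ to σ)  ≡⟨ sym (sum-permute (bit ∘ f) σ) ⟩
  sum (bit ∘ f)         ≡⟨ sym (countB≡sum f) ⟩
  countB f              ∎

countB-agree-off : ∀ {n} (f g : Fin n → Bool) (v : Fin n) →
  (∀ w → w ≢ v → f w ≡ g w) → countB f ≡ countB g → f v ≡ g v
countB-agree-off f g zero agree same =
  bit-injective (+-cancelʳ-≡ _ _ _
    (trans same (cong (bit (g zero) +_) (sym (countB-cong (λ i → agree (suc i) λ ()))))))
countB-agree-off f g (suc v) agree same =
  countB-agree-off (f ∘ suc) (g ∘ suc) v (λ w w≢v → agree (suc w) (w≢v ∘ suc-injective))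
    (+-cancelˡ-≡ _ _ _
      (trans same (cong (λ b → bit b + countB (g ∘ suc)) (sym (agree zero λ ())))))

x∧¬y∨x∧y≡x : ∀ x y → (x ∧ not y) ∨ (x ∧ y) ≡ x
x∧¬y∨x∧y≡x false y     = refl
x∧¬y∨x∧y≡x true  false = refl
x∧¬y∨x∧y≡x true  true  = refl

¬x∧y∨x∧y≡y : ∀ x y → (not x ∧ y) ∨ (x ∧ y) ≡ y
¬x∧y∨x∧y≡y false y = ∨-identityʳ y
¬x∧y∨x∧y≡y true  y = refl

to-injective : ∀ {n} (σ : Fin n ↔ Fin n) {i j} → to σ i ≡ to σ j → i ≡ j
to-injective σ = Injection.injective (↔⇒↣ σ)

eqB-transport : ∀ {n} (σ : Fin n ↔ Fin n) {u u'} → to σ u ≡ u' → ∀ i → eqB (to σ i) u' ≡ eqB i u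
eqB-transport σ {u} {u'} σu i with i ≟ u | to σ i ≟ u'
... | yes refl | yes _     = refl
... | yes refl | no σi≢u'  = contradiction σu σi≢u'
... | no i≢u   | yes σi≡u' = contradiction (to-injective σ (trans σi≡u' (sym σu))) i≢u
... | no _     | no _      = refl

≅-respʳ : ∀ {n m} {D : Digraph n} {E E' : Digraph m} → (∀ i j → E i j ≡ E' i j) → D ≅ E → D ≅ E'
≅-respʳ E≗E' f = record { bij = bij f ; pres = λ i j → trans (sym (E≗E' _ _)) (pres f i j) }

dt-≅ : ∀ {n} {D E : Digraph n} (f : D ≅ E) x → dt E (to (bij f) x) ≡ dt D x
dt-≅ {D = D} {E} f x = cong₂ _,_ (transport λ a b → a ∧ not b)
  (cong₂ _,_ (transport λ a b → not a ∧ b) (transport _∧_))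
  where
  t = to (bij f)
  transport : (op : Bool → Bool → Bool) →
    countB (λ w → op (E (t x) w) (E w (t x))) ≡ countB (λ w → op (D x w) (D w x))
  transport op = trans (sym (countB-permute (λ w → op (E (t x) w) (E w (t x))) (bij f)))
    (countB-cong λ w → cong₂ op (pres f x w) (pres f w x))

dt-cong : ∀ {n} {D E : Digraph n} → (∀ i j → D i j ≡ E i j) → ∀ x → dt D x ≡ dt E x
dt-cong D≗E x = sym (dt-≅ (record { bij = ↔-id _ ; pres = λ i j → sym (D≗E i j) }) x)

dt-agree-off : ∀ {n} (D E : Digraph n) (u v : Fin n) →
  (∀ w → w ≢ v → D u w ≡ E u w) → (∀ w → w ≢ v → D w u ≡ E w u) →
  dt D u ≡ dt E u → D u v ≡ E u v × D v u ≡ E v u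
dt-agree-off D E u v out inn same =
  trans (sym (x∧¬y∨x∧y≡x (D u v) (D v u))) (trans (cong₂ _∨_ only-out both) (x∧¬y∨x∧y≡x (E u v) (E v u))) ,
  trans (sym (¬x∧y∨x∧y≡y (D u v) (D v u))) (trans (cong₂ _∨_ only-in both) (¬x∧y∨x∧y≡y (E u v) (E v u)))
  where
  agree : (op : Bool → Bool → Bool) →
    countB (λ w → op (D u w) (D w u)) ≡ countB (λ w → op (E u w) (E w u)) →
    op (D u v) (D v u) ≡ op (E u v) (E v u)
  agree op = countB-agree-off (λ w → op (D u w) (D w u)) (λ w → op (E u w) (E w u)) v
    (λ w w≢v → cong₂ op (out w w≢v) (inn w w≢v))
  only-out = agree (λ a b → a ∧ not b) (cong proj₁ same)
  only-in  = agree (λ a b → not a ∧ b) (cong (proj₁ ∘ proj₂) same)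
  both     = agree _∧_ (cong (proj₂ ∘ proj₂) same)

NonAdjacent : ∀ {n} → Digraph n → Fin n → Fin n → Set
NonAdjacent P u v = P u v ≡ false × P v u ≡ false

addArcs-comm : ∀ {n} (P : Digraph n) u v b c i j → addArcs P u v b c i j ≡ addArcs P v u c b i j
addArcs-comm P u v b c i j = cong (P i j ∨_) (∨-comm (b ∧ eqB i u ∧ eqB j v) (c ∧ eqB i v ∧ eqB j u))

addArcs-off : ∀ {n} (P : Digraph n) u v b c {i j} →
  ¬ (i ≡ u × j ≡ v) → ¬ (i ≡ v × j ≡ u) → addArcs P u v b c i j ≡ P i j
addArcs-off P u v b c {i} {j} ¬uv ¬vu = begin
  P i j ∨ (b ∧ eqB i u ∧ eqB j v) ∨ (c ∧ eqB i v ∧ eqB j u)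
    ≡⟨ cong₂ (λ p q → P i j ∨ (b ∧ p) ∨ (c ∧ q))
             (dec-false ((i ≟ u) ×-dec (j ≟ v)) ¬uv) (dec-false ((i ≟ v) ×-dec (j ≟ u)) ¬vu) ⟩
  P i j ∨ (b ∧ false) ∨ (c ∧ false)
    ≡⟨ cong₂ (λ p q → P i j ∨ p ∨ q) (∧-zeroʳ b) (∧-zeroʳ c) ⟩
  P i j ∨ false
    ≡⟨ ∨-identityʳ (P i j) ⟩
  P i j ∎

addArcs-uv : ∀ {n} (P : Digraph n) {u v} b c → NonAdjacent P u v → u ≢ v → addArcs P u v b c u v ≡ b
addArcs-uv P {u} {v} b c (puv , _) u≢v = begin
  P u v ∨ (b ∧ eqB u u ∧ eqB v v) ∨ (c ∧ eqB u v ∧ eqB v u)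
    ≡⟨ cong₂ (λ p q → p ∨ (b ∧ q ∧ eqB v v) ∨ (c ∧ eqB u v ∧ eqB v u)) puv (dec-true (u ≟ u) refl) ⟩
  (b ∧ eqB v v) ∨ (c ∧ eqB u v ∧ eqB v u)
    ≡⟨ cong₂ (λ p q → (b ∧ p) ∨ (c ∧ q ∧ eqB v u)) (dec-true (v ≟ v) refl) (dec-false (u ≟ v) u≢v) ⟩
  (b ∧ true) ∨ (c ∧ false)
    ≡⟨ cong₂ _∨_ (∧-identityʳ b) (∧-zeroʳ c) ⟩
  b ∨ false
    ≡⟨ ∨-identityʳ b ⟩
  b ∎

addArcs-vu : ∀ {n} (P : Digraph n) {u v} b c → NonAdjacent P u v → u ≢ v → addArcs P u v b c v u ≡ c
addArcs-vu P {u} {v} b c (puv , pvu) u≢v =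
  trans (addArcs-comm P u v b c v u) (addArcs-uv P c b (pvu , puv) (u≢v ∘ sym))

addArcs-flags-unique : ∀ {n} {P : Digraph n} {u v b c b' c'} → u ≢ v → NonAdjacent P u v →
  dt (addArcs P u v b c) u ≡ dt (addArcs P u v b' c') u → b ≡ b' × c ≡ c'
addArcs-flags-unique {P = P} {u} {v} {b} {c} {b'} {c'} u≢v nonadj same =
  trans (sym (addArcs-uv P b c nonadj u≢v)) (trans (proj₁ arcs) (addArcs-uv P b' c' nonadj u≢v)) ,
  trans (sym (addArcs-vu P b c nonadj u≢v)) (trans (proj₂ arcs) (addArcs-vu P b' c' nonadj u≢v))
  where
  off : ∀ {i j} → ¬ (i ≡ u × j ≡ v) → ¬ (i ≡ v × j ≡ u) → addArcs P u v b c i j ≡ addArcs P u v b' c' i j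
  off ¬uv ¬vu = trans (addArcs-off P u v b c ¬uv ¬vu) (sym (addArcs-off P u v b' c' ¬uv ¬vu))
  arcs = dt-agree-off (addArcs P u v b c) (addArcs P u v b' c') u v
    (λ w w≢v → off (w≢v ∘ proj₂) (u≢v ∘ proj₁))
    (λ w w≢v → off (u≢v ∘ proj₂) (w≢v ∘ proj₁)) same

addArcs-≅ : ∀ {n} {P Q : Digraph n} {u v u' v'} (g : P ≅ Q) →
  to (bij g) u ≡ u' → to (bij g) v ≡ v' → ∀ b c → addArcs P u v b c ≅ addArcs Q u' v' b c
addArcs-≅ {P = P} {Q} {u} {v} {u'} {v'} g gu gv b c = record { bij = bij g ; pres = arcs }
  where
  t = to (bij g)
  arcs : ∀ i j → addArcs Q u' v' b c (t i) (t j) ≡ addArcs P u v b c i j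
  arcs i j = cong₂ _∨_ (pres g i j) (cong₂ _∨_
    (cong (b ∧_) (cong₂ _∧_ (eqB-transport (bij g) gu i) (eqB-transport (bij g) gv j)))
    (cong (c ∧_) (cong₂ _∧_ (eqB-transport (bij g) gv i) (eqB-transport (bij g) gu j))))

≅-restrict : ∀ {n} {P Q : Digraph n} {u v u' v' b c b' c'} (f : addArcs P u v b c ≅ addArcs Q u' v' b' c') →
  to (bij f) u ≡ u' → to (bij f) v ≡ v' → NonAdjacent P u v → NonAdjacent Q u' v' → P ≅ Q
≅-restrict {P = P} {Q} {u} {v} {u'} {v'} {b} {c} {b'} {c'} f fu fv (puv , pvu) (quv , qvu) =
  record { bij = bij f ; pres = arcs }
  where
  t = to (bij f)
  avoids : ∀ {x y x' y'} → t x ≡ x' → t y ≡ y' → ∀ {i j} → ¬ (i ≡ x × j ≡ y) → ¬ (t i ≡ x' × t j ≡ y')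
  avoids tx ty ¬xy (tix , tjy) =
    ¬xy (to-injective (bij f) (trans tix (sym tx)) , to-injective (bij f) (trans tjy (sym ty)))
  arcs : ∀ i j → Q (t i) (t j) ≡ P i j
  arcs i j with (i ≟ u) ×-dec (j ≟ v) | (i ≟ v) ×-dec (j ≟ u)
  ... | yes (refl , refl) | _                  = trans (cong₂ Q fu fv) (trans quv (sym puv))
  ... | no _              | yes (refl , refl)  = trans (cong₂ Q fv fu) (trans qvu (sym pvu))
  ... | no ¬uv            | no ¬vu             = begin
    Q (t i) (t j)                      ≡⟨ sym (addArcs-off Q u' v' b' c' (avoids fu fv ¬uv) (avoids fv fu ¬vu)) ⟩
    addArcs Q u' v' b' c' (t i) (t j)  ≡⟨ pres f i j ⟩
    addArcs P u v b c i j              ≡⟨ addArcs-off P u v b c ¬uv ¬vu ⟩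
    P i j                              ∎

completion-≅ : ∀ {n} {P Q : Digraph n} {u v u' v' b c b' c'} (g : P ≅ Q) →
  to (bij g) u ≡ u' → to (bij g) v ≡ v' → u ≢ v → NonAdjacent P u v →
  dt (addArcs P u v b c) u ≡ dt (addArcs Q u' v' b' c') u' → addArcs P u v b c ≅ addArcs Q u' v' b' c'
completion-≅ {P = P} {Q} {u} {v} {u'} {v'} {b} {c} {b'} {c'} g gu gv u≢v nonadj same =
  ≅-respʳ (λ i j → cong₂ (λ p q → addArcs Q u' v' p q i j) (proj₁ flags) (proj₂ flags))
          (addArcs-≅ g gu gv b c)
  where
  flags : b ≡ b' × c ≡ c'
  flags = addArcs-flags-unique {P = P} u≢v nonadj (begin
    dt (addArcs P u v b c) u                    ≡⟨ same ⟩
    dt (addArcs Q u' v' b' c') u'               ≡⟨ cong (dt (addArcs Q u' v' b' c')) (sym gu) ⟩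
    dt (addArcs Q u' v' b' c') (to (bij g) u)   ≡⟨ dt-≅ (addArcs-≅ g gu gv b' c') u ⟩
    dt (addArcs P u v b' c') u                  ∎)

externalLabel : ∀ {n} → Fin n → Fin n → Triple → Triple → Fin n → Maybe Triple
externalLabel u v α β w = if eqB w u then just α else if eqB w v then just β else nothing

LabelledIso : ∀ {n} (D E : Digraph n) (ℓ ℓ' : Fin n → Maybe Triple) → Set
LabelledIso D E ℓ ℓ' = Σ (D ≅ E) λ f → ∀ w → ℓ' (to (bij f) w) ≡ ℓ w

if-comm : ∀ {A : Set} p q (x y : A) →
  (if p then x else if q then x else y) ≡ (if q then x else if p then x else y)
if-comm false false x y = refl
if-comm false true  x y = refl
if-comm true  false x y = refl
if-comm true  true  x y = refl

externalLabel-transport : ∀ {n} (σ : Fin n ↔ Fin n) {u v u' v' α β} →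
  to σ u ≡ u' → to σ v ≡ v' → ∀ w → externalLabel u' v' α β (to σ w) ≡ externalLabel u v α β w
externalLabel-transport σ {α = α} {β} σu σv w =
  cong₂ (λ p q → if p then just α else if q then just β else nothing)
        (eqB-transport σ σu w) (eqB-transport σ σv w)

externalLabel-crossed : ∀ {n} (σ : Fin n ↔ Fin n) {u v u' v' α β} →
  to σ u ≡ v' → to σ v ≡ u' → α ≡ β → ∀ w → externalLabel u' v' α β (to σ w) ≡ externalLabel u v α β w
externalLabel-crossed σ {u' = u'} {v'} {α} σu σv refl w =
  trans (if-comm (eqB (to σ w) u') (eqB (to σ w) v') (just α) nothing)
        (externalLabel-transport σ σu σv w)

externalLabel-at-u : ∀ {n} (u v : Fin n) α β → externalLabel u v α β u ≡ just α
externalLabel-at-u u v α β =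
  cong (λ p → if p then just α else if eqB u v then just β else nothing) (dec-true (u ≟ u) refl)

externalLabel-at-v : ∀ {n} {u v : Fin n} α β → u ≢ v → externalLabel u v α β v ≡ just β
externalLabel-at-v {u = u} {v} α β u≢v =
  cong₂ (λ p q → if p then just α else if q then just β else nothing)
        (dec-false (v ≟ u) (u≢v ∘ sym)) (dec-true (v ≟ v) refl)

externalLabel-just : ∀ {n} (u v : Fin n) {α β γ} z → externalLabel u v α β z ≡ just γ →
  (z ≡ u × α ≡ γ) ⊎ (z ≡ v × β ≡ γ)
externalLabel-just u v z labelled with z ≟ u | z ≟ v
... | yes z≡u | _       = inj₁ (z≡u , just-injective labelled)
... | no _    | yes z≡v = inj₂ (z≡v , just-injective labelled)

module _ {n} {P₁ P₂ : Digraph n} {u₁ v₁ u₂ v₂ : Fin n} {b₁ c₁ b₂ c₂ : Bool} {α β : Triple} where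

  private
    Y₁ Y₂ : Digraph n
    Y₁ = addArcs P₁ u₁ v₁ b₁ c₁
    Y₂ = addArcs P₂ u₂ v₂ b₂ c₂

  labelledIso-from-extIso : NonAdjacent P₁ u₁ v₁ → NonAdjacent P₂ u₂ v₂ →
    dt Y₁ u₁ ≡ α → dt Y₂ v₂ ≡ β →
    ExtIso Y₁ Y₂ u₁ v₁ u₂ v₂ → LabelledIso P₁ P₂ (externalLabel u₁ v₁ α β) (externalLabel u₂ v₂ α β)
  labelledIso-from-extIso nonadj₁ nonadj₂ _ _ (f , inj₁ (fu , fv)) =
    ≅-restrict {P = P₁} {P₂} {b = b₁} {c₁} {b₂} {c₂} f fu fv nonadj₁ nonadj₂ ,
    externalLabel-transport (bij f) fu fv
  labelledIso-from-extIso nonadj₁ (quv , qvu) dt₁ dt₂ (f , inj₂ (fu , fv)) =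
    ≅-restrict {P = P₁} {P₂} {b = b₁} {c₁} {c₂} {b₂} (≅-respʳ (addArcs-comm P₂ u₂ v₂ b₂ c₂) f)
               fu fv nonadj₁ (qvu , quv) ,
    externalLabel-crossed (bij f) fu fv α≡β
    where
    α≡β : α ≡ β
    α≡β = begin
      α                     ≡⟨ sym dt₁ ⟩
      dt Y₁ u₁              ≡⟨ sym (dt-≅ f u₁) ⟩
      dt Y₂ (to (bij f) u₁) ≡⟨ cong (dt Y₂) fu ⟩
      dt Y₂ v₂              ≡⟨ dt₂ ⟩
      β                     ∎

  extIso-from-labelledIso : u₁ ≢ v₁ → NonAdjacent P₁ u₁ v₁ →
    dt Y₁ u₁ ≡ α → dt Y₂ u₂ ≡ α → dt Y₂ v₂ ≡ β →
    LabelledIso P₁ P₂ (externalLabel u₁ v₁ α β) (externalLabel u₂ v₂ α β) →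
    ExtIso Y₁ Y₂ u₁ v₁ u₂ v₂
  extIso-from-labelledIso u₁≢v₁ nonadj dt₁ dtu₂ dtv₂ (g , labels)
    with externalLabel-just u₂ v₂ (to (bij g) u₁) (trans (labels u₁) (externalLabel-at-u u₁ v₁ α β))
       | externalLabel-just u₂ v₂ (to (bij g) v₁) (trans (labels v₁) (externalLabel-at-v α β u₁≢v₁))
  ... | inj₁ (gu , _) | inj₂ (gv , _) =
    completion-≅ {b = b₁} {c₁} {b₂} {c₂} g gu gv u₁≢v₁ nonadj (trans dt₁ (sym dtu₂)) , inj₁ (gu , gv)
  ... | inj₂ (gu , β≡α) | inj₁ (gv , _) =
    ≅-respʳ (addArcs-comm P₂ v₂ u₂ c₂ b₂)
            (completion-≅ {b = b₁} {c₁} {c₂} {b₂} g gu gv u₁≢v₁ nonadj crossed) ,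
    inj₂ (gu , gv)
    where
    crossed : dt Y₁ u₁ ≡ dt (addArcs P₂ v₂ u₂ c₂ b₂) v₂
    crossed = begin
      dt Y₁ u₁                          ≡⟨ dt₁ ⟩
      α                                 ≡⟨ sym β≡α ⟩
      β                                 ≡⟨ sym dtv₂ ⟩
      dt Y₂ v₂                          ≡⟨ dt-cong (addArcs-comm P₂ u₂ v₂ b₂ c₂) v₂ ⟩
      dt (addArcs P₂ v₂ u₂ c₂ b₂) v₂    ∎
  ... | inj₁ (gu , _) | inj₁ (gv , _) = contradiction (to-injective (bij g) (trans gu (sym gv))) u₁≢v₁
  ... | inj₂ (gu , _) | inj₂ (gv , _) = contradiction (to-injective (bij g) (trans gu (sym gv))) u₁≢v₁

theorem5p2 : ∀ {n} (G : Digraph (suc n)) → Loopless G →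
    (x y : Fin (suc n)) → ¬ (x ≡ y) →
    (P₁ P₂ : Dapasting G x y) →
    (b₁ c₁ : Bool) →
    CompletionCond G x y (Dapasting.P P₁) (Dapasting.u P₁) (Dapasting.v P₁) b₁ c₁ →
    (b₂ c₂ : Bool) →
    CompletionCond G x y (Dapasting.P P₂) (Dapasting.u P₂) (Dapasting.v P₂) b₂ c₂ →
    ExtIso (addArcs (Dapasting.P P₁) (Dapasting.u P₁) (Dapasting.v P₁) b₁ c₁)
           (addArcs (Dapasting.P P₂) (Dapasting.u P₂) (Dapasting.v P₂) b₂ c₂)
           (Dapasting.u P₁) (Dapasting.v P₁) (Dapasting.u P₂) (Dapasting.v P₂)
      ⇔ DapIso P₁ P₂
theorem5p2 G _ x y _ P₁ P₂ b₁ c₁ (dt₁ , _) b₂ c₂ (dtu₂ , dtv₂ , _) = mk⇔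
  (labelledIso-from-extIso {b₁ = b₁} {c₁} {b₂} {c₂} (nonAdjacent P₁) (nonAdjacent P₂) dt₁ dtv₂)
  (extIso-from-labelledIso {b₁ = b₁} {c₁} {b₂} {c₂} (u≢v P₁) (nonAdjacent P₁) dt₁ dtu₂ dtv₂)
  where
  open Dapasting
  nonAdjacent : (Q : Dapasting G x y) → NonAdjacent (P Q) (u Q) (v Q)
  nonAdjacent Q = nonadjUV Q , nonadjVU Q
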